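{- Let $n$ be a positive integer and let $G$ be a divisible design graph with parameters $(4n,3n-2,3n-6,2n-2,4,n)$ whose canonical partition $V_1,V_2,V_3,V_4$ has quotient matrix $$\begin{pmatrix} 1&n-1&n-1&n-1\\ n-1&1&n-1&n-1\\ n-1&n-1&1&n-1\\ n-1&n-1&n-1&1\end{pmatrix}.$$ Let $G'$ be the graph obtained from $G$ by complementing all adjacencies between a vertex of $V_1\cup V_2$ and a vertex of $V_3\cup V_4$ (other adjacencies unchanged). Then $G'$ is a divisible design graph with parameters $(4n,n+2,n-2,2,4,n)$ (with canonical partition $V_1,\dots,V_4$) and quotient matrix $$\begin{pmatrix} 1&n-1&1&1\\ n-1&1&1&1\\ 1&1&1&n-1\\ 1&1&n-1&1\end{pmatrix}.$$
   Context: A divisible design graph (DDG) with parameters $(v,k,\lambda_1,\lambda_2,m,n)$ is a $k$-regular graph on $v=mn$ vertices whose vertex set can be partitioned into $m$ classes of size $n$ (a canonical partition) such that any two distinct vertices in the same class have exactly $\lambda_1$ common neighbours and any two vertices in different classes have exactly $\lambda_2$ common neighbours. The quotient matrix $(r_{ij})$ means every vertex of $V_i$ has exactly $r_{ij}$ neighbours in $V_j$. -}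

module Defs where

open import Data.Nat using (ℕ; _+_; _*_; _∸_)
import Data.Nat
import Data.Bool
open import Data.Bool using (Bool; true; false; not; if_then_else_; _∧_)
open import Data.Fin using (Fin; zero; suc)
open import Data.Vec.Functional using (Vector)
open import Relation.Binary.PropositionalEquality using (_≡_; _≢_)
open import Relation.Nullary.Decidable using (⌊_⌋)
open import Data.Fin using (_≟_)

count : ∀ {v} → (Fin v → Bool) → ℕ
count {ℕ.zero} p = 0
count {ℕ.suc v} p = (if p zero then 1 else 0) + count (λ i → p (suc i))

record IsSimpleGraph {v : ℕ} (adj : Fin v → Fin v → Bool) : Set where
  field
    symmetric   : ∀ x y → adj x y ≡ adj y x
    irreflexive : ∀ x → adj x x ≡ false

degree : ∀ {v} → (Fin v → Fin v → Bool) → Fin v → ℕ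
degree adj x = count (adj x)

common : ∀ {v} → (Fin v → Fin v → Bool) → Fin v → Fin v → ℕ
common adj x y = count (λ z → adj x z ∧ adj y z)

nbrsIn : ∀ {v m} → (Fin v → Fin v → Bool) → (Fin v → Fin m) → Fin v → Fin m → ℕ
nbrsIn adj cls x j = count (λ z → adj x z ∧ ⌊ cls z ≟ j ⌋)

record IsDDG (v k λ₁ λ₂ m n : ℕ) (adj : Fin v → Fin v → Bool)
             (cls : Fin v → Fin m) : Set where
  field
    simple      : IsSimpleGraph adj
    vertices    : v ≡ m * n
    classSize   : ∀ (j : Fin m) → count (λ z → ⌊ cls z ≟ j ⌋) ≡ n
    regular     : ∀ x → degree adj x ≡ k
    sameClass   : ∀ x y → x ≢ y → cls x ≡ cls y → common adj x y ≡ λ₁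
    diffClass   : ∀ x y → cls x ≢ cls y → common adj x y ≡ λ₂

HasQuotient : ∀ {v m} → (Fin v → Fin v → Bool) → (Fin v → Fin m)
            → (Fin m → Fin m → ℕ) → Set
HasQuotient adj cls r = ∀ x j → nbrsIn adj cls x j ≡ r (cls x) j

-- Classes V₁,V₂ are indices 0,1 ("low half"); V₃,V₄ are indices 2,3.
low : Fin 4 → Bool
low zero = true
low (suc zero) = true
low _ = false

switch : ∀ {v} → (Fin v → Fin v → Bool) → (Fin v → Fin 4) → Fin v → Fin v → Bool
switch adj cls x y with low (cls x) | low (cls y)
... | true  | false = not (adj x y)
... | false | true  = not (adj x y)
... | _     | _     = adj x y

Q₁ : ℕ → Fin 4 → Fin 4 → ℕ
Q₁ n i j = if ⌊ i ≟ j ⌋ then 1 else n Data.Nat.∸ 1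

-- Quotient matrix of G': 1 on the diagonal, n-1 on the entries
-- (1,2),(2,1),(3,4),(4,3), and 1 elsewhere.
Q₂ : ℕ → Fin 4 → Fin 4 → ℕ
Q₂ n i j = if ⌊ i ≟ j ⌋ then 1 else (if ⌊ Data.Bool._≟_ (low i) (low j) ⌋ then n Data.Nat.∸ 1 else 1)

{-# OPTIONS --safe #-}
-- In G′ the vertices x and z are adjacent iff (x ~ z in G) xor (x and z lie on opposite sides
-- of the cut V₁ ∪ V₂ | V₃ ∪ V₄).  Across the cut, the n − 1 neighbours of a vertex in a class of
-- size n therefore become n − (n − 1) = 1, which gives the quotient matrix and the degree.
-- For common neighbours, a truth-table identity at each vertex z, summed over z, gives
-- λ′ + 4(n − 1) = λ + 2n when x and y lie on the same side (each has 2(n − 1) neighbours among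
-- the 2n vertices across) and λ′ + λ = n + n when they lie on opposite sides (each has n
-- neighbours on its own side); with λ = 3n − 6 resp. 2n − 2 this yields n − 2 and 2.
module Submission where

open import Defs
open import Data.Nat using (ℕ; zero; suc; _+_; _*_; _∸_; _≤_; _≥_; s≤s; z≤n)
open import Data.Nat.Properties
  using (+-0-commutativeMonoid; ≤-trans; m≤n+m; +-identityʳ; +-comm; +-suc; +-cancelʳ-≡; *-distribˡ-+; m+n∸m≡n)
open import Data.Bool using (Bool; true; false; not; if_then_else_; _∧_; _xor_)
open import Data.Bool.Properties
  using (∧-identityʳ; ∧-zeroʳ; xor-identityʳ; xor-comm; xor-same; not-distribˡ-xor; ¬-not)
  renaming (_≟_ to _≟ᵇ_)
open import Data.Fin using (Fin; zero; suc; _≟_)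
open import Data.List using (List; []; _∷_)
open import Data.Product using (_×_; _,_)
open import Function using (_∘_)
open import Data.Nat.Tactic.RingSolver using (solve-∀)
open import Relation.Binary.PropositionalEquality
open import Relation.Nullary.Decidable using (⌊_⌋; yes; no; isYes≗does; dec-true)
open import Relation.Nullary.Negation using (contradiction)
open import Algebra.Properties.CommutativeMonoid.Sum +-0-commutativeMonoid
  using (sum; sum-cong-≗; ∑-distrib-+; ∑-comm; sum-replicate-zero)

𝟙 : Bool → ℕ
𝟙 b = if b then 1 else 0

count-sum : ∀ {v} (p : Fin v → Bool) → count p ≡ sum (𝟙 ∘ p)
count-sum {zero} p = refl
count-sum {suc v} p = cong (𝟙 (p zero) +_) (count-sum (p ∘ suc))

count-cong : ∀ {v} {p q : Fin v → Bool} → (∀ z → p z ≡ q z) → count p ≡ count q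
count-cong {p = p} {q} p≗q = begin
  count p       ≡⟨ count-sum p ⟩
  sum (𝟙 ∘ p)   ≡⟨ sum-cong-≗ (cong 𝟙 ∘ p≗q) ⟩
  sum (𝟙 ∘ q)   ≡⟨ count-sum q ⟨
  count q       ∎
  where open ≡-Reasoning

total : ∀ {v} → List (Fin v → Bool) → ℕ
total []           = 0
total (p ∷ [])     = count p
total (p ∷ p′ ∷ ps) = count p + total (p′ ∷ ps)

multiplicity : ∀ {v} → List (Fin v → Bool) → Fin v → ℕ
multiplicity []           z = 0
multiplicity (p ∷ [])     z = 𝟙 (p z)
multiplicity (p ∷ p′ ∷ ps) z = 𝟙 (p z) + multiplicity (p′ ∷ ps) z

total-sum : ∀ {v} (ps : List (Fin v → Bool)) → total ps ≡ sum (multiplicity ps)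
total-sum {v} []   = sym (sum-replicate-zero v)
total-sum (p ∷ []) = count-sum p
total-sum (p ∷ p′ ∷ ps) = begin
  count p + total (p′ ∷ ps)                       ≡⟨ cong₂ _+_ (count-sum p) (total-sum (p′ ∷ ps)) ⟩
  sum (𝟙 ∘ p) + sum (multiplicity (p′ ∷ ps))      ≡⟨ ∑-distrib-+ (𝟙 ∘ p) (multiplicity (p′ ∷ ps)) ⟨
  sum (multiplicity (p ∷ p′ ∷ ps))                ∎
  where open ≡-Reasoning

total-cong : ∀ {v} (ps qs : List (Fin v → Bool)) →
  (∀ z → multiplicity ps z ≡ multiplicity qs z) → total ps ≡ total qs
total-cong ps qs same = begin
  total ps               ≡⟨ total-sum ps ⟩
  sum (multiplicity ps)  ≡⟨ sum-cong-≗ same ⟩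
  sum (multiplicity qs)  ≡⟨ total-sum qs ⟨
  total qs               ∎
  where open ≡-Reasoning

count-false : ∀ {v} → count {v} (λ _ → false) ≡ 0
count-false {zero}  = refl
count-false {suc v} = count-false {v}

count-∧-constˡ : ∀ {v} b (p : Fin v → Bool) → count (λ z → b ∧ p z) ≡ (if b then count p else 0)
count-∧-constˡ {v} false p = count-false {v}
count-∧-constˡ     true  p = refl

count-∧-constʳ : ∀ {v} (p : Fin v → Bool) b → count (λ z → p z ∧ b) ≡ (if b then count p else 0)
count-∧-constʳ     p true  = count-cong (∧-identityʳ ∘ p)
count-∧-constʳ {v} p false = trans (count-cong (∧-zeroʳ ∘ p)) (count-false {v})

count-≟ : ∀ {m} (i : Fin m) → count (λ j → ⌊ i ≟ j ⌋) ≡ 1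
count-≟ {suc m} zero    = cong suc (count-false {m})
count-≟         (suc i) = trans (count-cong suc≟suc) (count-≟ i)
  where
  suc≟suc : ∀ j → ⌊ suc i ≟ suc j ⌋ ≡ ⌊ i ≟ j ⌋
  suc≟suc j with i ≟ j
  ... | yes _ = refl
  ... | no  _ = refl

count-partition : ∀ {v m} (cls : Fin v → Fin m) (p : Fin v → Bool) →
  count p ≡ sum (λ j → count (λ z → p z ∧ ⌊ cls z ≟ j ⌋))
count-partition {v} {m} cls p = begin
  count p                                          ≡⟨ count-sum p ⟩
  sum (λ z → 𝟙 (p z))                              ≡⟨ sum-cong-≗ {v} one-class ⟨
  sum (λ z → sum (λ j → 𝟙 (p z ∧ ⌊ cls z ≟ j ⌋)))  ≡⟨ ∑-comm (λ z j → 𝟙 (p z ∧ ⌊ cls z ≟ j ⌋)) ⟩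
  sum (λ j → sum (λ z → 𝟙 (p z ∧ ⌊ cls z ≟ j ⌋)))  ≡⟨ sum-cong-≗ {m} (λ j → count-sum {v} _) ⟨
  sum (λ j → count (λ z → p z ∧ ⌊ cls z ≟ j ⌋))    ∎
  where
  open ≡-Reasoning
  one-class : ∀ z → sum (λ j → 𝟙 (p z ∧ ⌊ cls z ≟ j ⌋)) ≡ 𝟙 (p z)
  one-class z = begin
    sum (λ j → 𝟙 (p z ∧ ⌊ cls z ≟ j ⌋))       ≡⟨ count-sum {m} _ ⟨
    count (λ j → p z ∧ ⌊ cls z ≟ j ⌋)         ≡⟨ count-∧-constˡ {m} (p z) _ ⟩
    (if p z then count (λ j → ⌊ cls z ≟ j ⌋) else 0) ≡⟨ cong (if p z then_else 0) (count-≟ (cls z)) ⟩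
    𝟙 (p z)                                   ∎

count-∧-classes : ∀ {v m} (cls : Fin v → Fin m) (P : Fin m → Bool) (p : Fin v → Bool) →
  count (λ z → p z ∧ P (cls z)) ≡ sum (λ j → if P j then count (λ z → p z ∧ ⌊ cls z ≟ j ⌋) else 0)
count-∧-classes cls P p = trans (count-partition cls _) (sum-cong-≗ λ j →
  trans (count-cong (move-class j)) (count-∧-constʳ (λ z → p z ∧ ⌊ cls z ≟ j ⌋) (P j)))
  where
  move-class : ∀ j z → (p z ∧ P (cls z)) ∧ ⌊ cls z ≟ j ⌋ ≡ (p z ∧ ⌊ cls z ≟ j ⌋) ∧ P j
  move-class j z with cls z ≟ j
  ... | yes refl = trans (∧-identityʳ _) (cong (_∧ P (cls z)) (sym (∧-identityʳ (p z))))
  ... | no  _    = trans (∧-zeroʳ _) (cong (_∧ P j) (sym (∧-zeroʳ (p z))))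

one≤count : ∀ {v} (p : Fin v → Bool) {x} → p x ≡ true → 1 ≤ count p
one≤count p {zero}  px rewrite px = s≤s z≤n
one≤count p {suc x} px = ≤-trans (one≤count (p ∘ suc) px) (m≤n+m _ (𝟙 (p zero)))

two≤count : ∀ {v} (p : Fin v → Bool) {x y} → x ≢ y → p x ≡ true → p y ≡ true → 2 ≤ count p
two≤count p {zero}  {zero}  x≢y _  _  = contradiction refl x≢y
two≤count p {zero}  {suc y} _   px py rewrite px = s≤s (one≤count (p ∘ suc) py)
two≤count p {suc x} {zero}  _   px py rewrite py = s≤s (one≤count (p ∘ suc) px)
two≤count p {suc x} {suc y} x≢y px py =
  ≤-trans (two≤count (p ∘ suc) (x≢y ∘ cong suc) px py) (m≤n+m _ (𝟙 (p zero)))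

𝟙-complement : ∀ a e → 𝟙 ((a xor true) ∧ e) + 𝟙 (a ∧ e) ≡ 𝟙 e
𝟙-complement false false = refl
𝟙-complement false true  = refl
𝟙-complement true  false = refl
𝟙-complement true  true  = refl

𝟙-common-same-side : ∀ a b o →
  𝟙 ((a xor o) ∧ (b xor o)) + (𝟙 (a ∧ o) + 𝟙 (b ∧ o)) ≡ 𝟙 (a ∧ b) + 𝟙 o
𝟙-common-same-side false false false = refl
𝟙-common-same-side false false true  = refl
𝟙-common-same-side false true  false = refl
𝟙-common-same-side false true  true  = refl
𝟙-common-same-side true  false false = refl
𝟙-common-same-side true  false true  = refl
𝟙-common-same-side true  true  false = refl
𝟙-common-same-side true  true  true  = refl

𝟙-common-opposite-sides : ∀ a b o →
  𝟙 ((a xor o) ∧ (b xor not o)) + 𝟙 (a ∧ b) ≡ 𝟙 (a ∧ not o) + 𝟙 (b ∧ not (not o))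
𝟙-common-opposite-sides false false false = refl
𝟙-common-opposite-sides false false true  = refl
𝟙-common-opposite-sides false true  false = refl
𝟙-common-opposite-sides false true  true  = refl
𝟙-common-opposite-sides true  false false = refl
𝟙-common-opposite-sides true  false true  = refl
𝟙-common-opposite-sides true  true  false = refl
𝟙-common-opposite-sides true  true  true  = refl

crossing : Fin 4 → Fin 4 → Bool
crossing i j = low i xor low j

module _ {v : ℕ} (adj : Fin v → Fin v → Bool) (cls : Fin v → Fin 4) where

  switch-xor : ∀ x y → switch adj cls x y ≡ adj x y xor crossing (cls x) (cls y)
  switch-xor x y with low (cls x) | low (cls y)
  ... | true  | true  = sym (xor-identityʳ _)
  ... | true  | false = xor-comm true (adj x y)
  ... | false | true  = xor-comm true (adj x y)
  ... | false | false = sym (xor-identityʳ _)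

  switch-simple : IsSimpleGraph adj → IsSimpleGraph (switch adj cls)
  switch-simple G = record
    { symmetric   = λ x y → begin
        switch adj cls x y                           ≡⟨ switch-xor x y ⟩
        adj x y xor crossing (cls x) (cls y)         ≡⟨ cong₂ _xor_ (symmetric x y) (crossing-comm (cls x) (cls y)) ⟩
        adj y x xor crossing (cls y) (cls x)         ≡⟨ switch-xor y x ⟨
        switch adj cls y x                           ∎
    ; irreflexive = λ x → begin
        switch adj cls x x                           ≡⟨ switch-xor x x ⟩
        adj x x xor crossing (cls x) (cls x)         ≡⟨ cong₂ _xor_ (irreflexive x) (xor-same (low (cls x))) ⟩
        false                                        ∎
    }
    where
    open IsSimpleGraph G
    open ≡-Reasoning
    crossing-comm : ∀ i j → crossing i j ≡ crossing j i
    crossing-comm i j = xor-comm (low i) (low j)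

  switch-within-class : ∀ {x j c} → crossing (cls x) j ≡ c → ∀ z →
    switch adj cls x z ∧ ⌊ cls z ≟ j ⌋ ≡ (adj x z xor c) ∧ ⌊ cls z ≟ j ⌋
  switch-within-class {x} {j} refl z with cls z ≟ j
  ... | yes refl = cong (_∧ true) (switch-xor x z)
  ... | no  _    = trans (∧-zeroʳ _) (sym (∧-zeroʳ _))

  nbrsIn-switch-uncrossed : ∀ x j → crossing (cls x) j ≡ false →
    nbrsIn (switch adj cls) cls x j ≡ nbrsIn adj cls x j
  nbrsIn-switch-uncrossed x j uncrossed = count-cong λ z →
    trans (switch-within-class uncrossed z) (cong (_∧ ⌊ cls z ≟ j ⌋) (xor-identityʳ (adj x z)))

  nbrsIn-switch-crossed : ∀ x j → crossing (cls x) j ≡ true →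
    nbrsIn (switch adj cls) cls x j + nbrsIn adj cls x j ≡ count (λ z → ⌊ cls z ≟ j ⌋)
  nbrsIn-switch-crossed x j crossed = total-cong (_ ∷ _ ∷ []) (_ ∷ []) λ z →
    trans (cong (λ b → 𝟙 b + 𝟙 (adj x z ∧ ⌊ cls z ≟ j ⌋)) (switch-within-class crossed z))
          (𝟙-complement (adj x z) ⌊ cls z ≟ j ⌋)

  common-switch-same-side : ∀ x y → low (cls x) ≡ low (cls y) →
    common (switch adj cls) x y
      + (count (λ z → adj x z ∧ crossing (cls x) (cls z)) + count (λ z → adj y z ∧ crossing (cls y) (cls z)))
    ≡ common adj x y + count (λ z → crossing (cls x) (cls z))
  common-switch-same-side x y same-side = total-cong (_ ∷ _ ∷ _ ∷ []) (_ ∷ _ ∷ []) pointwise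
    where
    pointwise : ∀ z → 𝟙 (switch adj cls x z ∧ switch adj cls y z)
        + (𝟙 (adj x z ∧ crossing (cls x) (cls z)) + 𝟙 (adj y z ∧ crossing (cls y) (cls z)))
      ≡ 𝟙 (adj x z ∧ adj y z) + 𝟙 (crossing (cls x) (cls z))
    pointwise z rewrite switch-xor x z | switch-xor y z | sym same-side =
      𝟙-common-same-side (adj x z) (adj y z) (crossing (cls x) (cls z))

  common-switch-opposite-sides : ∀ x y → low (cls y) ≡ not (low (cls x)) →
    common (switch adj cls) x y + common adj x y
    ≡ count (λ z → adj x z ∧ not (crossing (cls x) (cls z))) + count (λ z → adj y z ∧ not (crossing (cls y) (cls z)))
  common-switch-opposite-sides x y opposite = total-cong (_ ∷ _ ∷ []) (_ ∷ _ ∷ []) pointwise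
    where
    pointwise : ∀ z → 𝟙 (switch adj cls x z ∧ switch adj cls y z) + 𝟙 (adj x z ∧ adj y z)
      ≡ 𝟙 (adj x z ∧ not (crossing (cls x) (cls z))) + 𝟙 (adj y z ∧ not (crossing (cls y) (cls z)))
    pointwise z rewrite switch-xor x z | switch-xor y z | opposite
                      | sym (not-distribˡ-xor (low (cls x)) (low (cls z))) =
      𝟙-common-opposite-sides (adj x z) (adj y z) (crossing (cls x) (cls z))

Q₂-switched : ∀ n i j → Q₂ n i j ≡ (if crossing i j then 1 else Q₁ n i j)
Q₂-switched n i j with i ≟ j
... | yes refl rewrite xor-same (low i) = refl
... | no  _ with low i | low j
...   | false | false = refl
...   | false | true  = refl
...   | true  | false = refl
...   | true  | true  = refl

Q₁-crossed : ∀ n i j → crossing i j ≡ true → Q₁ n i j ≡ n ∸ 1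
Q₁-crossed n i j crossed with i ≟ j
... | yes refl = contradiction (trans (sym (xor-same (low i))) crossed) λ ()
... | no  _    = refl

Q₁-row-across : ∀ n i → sum (λ j → if crossing i j then Q₁ n i j else 0) ≡ 2 * (n ∸ 1)
Q₁-row-across n zero                   = refl
Q₁-row-across n (suc zero)             = refl
Q₁-row-across n (suc (suc zero))       = refl
Q₁-row-across n (suc (suc (suc zero))) = refl

Q₁-row-own-side : ∀ m i → sum (λ j → if not (crossing i j) then Q₁ (suc m) i j else 0) ≡ suc m
Q₁-row-own-side m zero                   = cong suc (+-identityʳ m)
Q₁-row-own-side m (suc zero)             = +-comm m 1
Q₁-row-own-side m (suc (suc zero))       = cong suc (+-identityʳ m)
Q₁-row-own-side m (suc (suc (suc zero))) = +-comm m 1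

class-sizes-across : ∀ n i → sum (λ j → if crossing i j then n else 0) ≡ 2 * n
class-sizes-across n zero                   = refl
class-sizes-across n (suc zero)             = refl
class-sizes-across n (suc (suc zero))       = refl
class-sizes-across n (suc (suc (suc zero))) = refl

Q₂-row-sum : ∀ m i → sum (Q₂ (suc m) i) ≡ suc m + 2
Q₂-row-sum m zero                   = refl
Q₂-row-sum m (suc zero)             = +-suc m 2
Q₂-row-sum m (suc (suc zero))       = cong suc (trans (cong (2 +_) (+-identityʳ m)) (+-comm 2 m))
Q₂-row-sum m (suc (suc (suc zero))) = cong suc (sym (+-suc m 1))

Q₂-crossed : ∀ n i j → crossing i j ≡ true → Q₂ n i j ≡ 1
Q₂-crossed n i j crossed = trans (Q₂-switched n i j) (cong (if_then 1 else Q₁ n i j) crossed)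

Q₂-uncrossed : ∀ n i j → crossing i j ≡ false → Q₂ n i j ≡ Q₁ n i j
Q₂-uncrossed n i j uncrossed = trans (Q₂-switched n i j) (cong (if_then 1 else Q₁ n i j) uncrossed)

2*suc∸2 : ∀ m → 2 * suc m ∸ 2 ≡ 2 * m
2*suc∸2 m = trans (cong (_∸ 2) (*-distribˡ-+ 2 1 m)) (m+n∸m≡n 2 (2 * m))

3*suc²∸6 : ∀ k → 3 * suc (suc k) ∸ 6 ≡ 3 * k
3*suc²∸6 k = trans (cong (_∸ 6) (*-distribˡ-+ 3 2 k)) (m+n∸m≡n 6 (3 * k))

-- Both 3n ∸ 6 and n ∸ 2 are truncated; the premise n ≥ 2 is what makes them the true values.
same-class-arithmetic : ∀ m c → 2 ≤ suc m →
  c + (2 * m + 2 * m) ≡ (3 * suc m ∸ 6) + 2 * suc m → c ≡ suc m ∸ 2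
same-class-arithmetic zero    c (s≤s ()) _
same-class-arithmetic (suc k) c _ eq =
  +-cancelʳ-≡ _ c k (trans eq (trans (cong (_+ 2 * suc (suc k)) (3*suc²∸6 k)) (rearrange k)))
  where
  rearrange : ∀ k → 3 * k + 2 * suc (suc k) ≡ k + (2 * suc k + 2 * suc k)
  rearrange = solve-∀

same-side-arithmetic : ∀ m c → c + (2 * m + 2 * m) ≡ (2 * suc m ∸ 2) + 2 * suc m → c ≡ 2
same-side-arithmetic m c eq =
  +-cancelʳ-≡ _ c 2 (trans eq (trans (cong (_+ 2 * suc m) (2*suc∸2 m)) (rearrange m)))
  where
  rearrange : ∀ m → 2 * m + 2 * suc m ≡ 2 + (2 * m + 2 * m)
  rearrange = solve-∀

opposite-sides-arithmetic : ∀ m c → c + (2 * suc m ∸ 2) ≡ suc m + suc m → c ≡ 2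
opposite-sides-arithmetic m c eq =
  +-cancelʳ-≡ _ c 2 (trans (cong (c +_) (sym (2*suc∸2 m))) (trans eq (rearrange m)))
  where
  rearrange : ∀ m → suc m + suc m ≡ 2 + 2 * m
  rearrange = solve-∀

module SwitchedDDG {v m : ℕ} {adj : Fin v → Fin v → Bool} {cls : Fin v → Fin 4}
  (G : IsDDG v (3 * suc m ∸ 2) (3 * suc m ∸ 6) (2 * suc m ∸ 2) 4 (suc m) adj cls)
  (quotient : HasQuotient adj cls (Q₁ (suc m))) where

  open IsDDG G

  S : Fin v → Fin v → Bool
  S = switch adj cls

  neighbours-in : ∀ x (P : Fin 4 → Bool) →
    count (λ z → adj x z ∧ P (cls z)) ≡ sum (λ j → if P j then Q₁ (suc m) (cls x) j else 0)
  neighbours-in x P = trans (count-∧-classes cls P (adj x))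
    (sum-cong-≗ {4} λ j → cong (if P j then_else 0) (quotient x j))

  neighbours-across : ∀ x → count (λ z → adj x z ∧ crossing (cls x) (cls z)) ≡ 2 * m
  neighbours-across x = trans (neighbours-in x (crossing (cls x))) (Q₁-row-across (suc m) (cls x))

  neighbours-own-side : ∀ x → count (λ z → adj x z ∧ not (crossing (cls x) (cls z))) ≡ suc m
  neighbours-own-side x = trans (neighbours-in x (not ∘ crossing (cls x))) (Q₁-row-own-side m (cls x))

  size-across : ∀ x → count (λ z → crossing (cls x) (cls z)) ≡ 2 * suc m
  size-across x = trans (count-∧-classes cls (crossing (cls x)) (λ _ → true))
    (trans (sum-cong-≗ {4} λ j → cong (if crossing (cls x) j then_else 0) (classSize j))
           (class-sizes-across (suc m) (cls x)))

  switch-quotient : HasQuotient S cls (Q₂ (suc m))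
  switch-quotient x j with crossing (cls x) j in crossed
  ... | false = trans (nbrsIn-switch-uncrossed adj cls x j crossed)
                      (trans (quotient x j) (sym (Q₂-uncrossed (suc m) (cls x) j crossed)))
  ... | true  = trans (+-cancelʳ-≡ m _ 1 (begin
      nbrsIn S cls x j + m
        ≡⟨ cong (nbrsIn S cls x j +_) (trans (quotient x j) (Q₁-crossed (suc m) (cls x) j crossed)) ⟨
      nbrsIn S cls x j + nbrsIn adj cls x j
        ≡⟨ nbrsIn-switch-crossed adj cls x j crossed ⟩
      count (λ z → ⌊ cls z ≟ j ⌋)
        ≡⟨ classSize j ⟩
      suc m
        ∎)) (sym (Q₂-crossed (suc m) (cls x) j crossed))
    where open ≡-Reasoning

  switch-regular : ∀ x → degree S x ≡ suc m + 2
  switch-regular x = begin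
    degree S x                ≡⟨ count-partition cls (S x) ⟩
    sum (nbrsIn S cls x)      ≡⟨ sum-cong-≗ {4} (switch-quotient x) ⟩
    sum (Q₂ (suc m) (cls x))  ≡⟨ Q₂-row-sum m (cls x) ⟩
    suc m + 2                 ∎
    where open ≡-Reasoning

  class-size≥2 : ∀ x y → x ≢ y → cls x ≡ cls y → 2 ≤ suc m
  class-size≥2 x y x≢y same-class = subst (2 ≤_) (classSize (cls x))
    (two≤count (λ z → ⌊ cls z ≟ cls x ⌋) x≢y (in-class refl) (in-class (sym same-class)))
    where
    in-class : ∀ {z} → cls z ≡ cls x → ⌊ cls z ≟ cls x ⌋ ≡ true
    in-class {z} e = trans (isYes≗does (cls z ≟ cls x)) (dec-true (cls z ≟ cls x) e)

  switch-common-same-side : ∀ x y → low (cls x) ≡ low (cls y) →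
    common S x y + (2 * m + 2 * m) ≡ common adj x y + 2 * suc m
  switch-common-same-side x y same-side = begin
    common S x y + (2 * m + 2 * m)
      ≡⟨ cong (common S x y +_) (cong₂ _+_ (neighbours-across x) (neighbours-across y)) ⟨
    common S x y
      + (count (λ z → adj x z ∧ crossing (cls x) (cls z)) + count (λ z → adj y z ∧ crossing (cls y) (cls z)))
      ≡⟨ common-switch-same-side adj cls x y same-side ⟩
    common adj x y + count (λ z → crossing (cls x) (cls z))
      ≡⟨ cong (common adj x y +_) (size-across x) ⟩
    common adj x y + 2 * suc m
      ∎
    where open ≡-Reasoning

  switch-common-opposite-sides : ∀ x y → low (cls y) ≡ not (low (cls x)) →
    common S x y + common adj x y ≡ suc m + suc m
  switch-common-opposite-sides x y opposite =
    trans (common-switch-opposite-sides adj cls x y opposite)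
          (cong₂ _+_ (neighbours-own-side x) (neighbours-own-side y))

  switch-same-class : ∀ x y → x ≢ y → cls x ≡ cls y → common S x y ≡ suc m ∸ 2
  switch-same-class x y x≢y same-class = same-class-arithmetic m _ (class-size≥2 x y x≢y same-class)
    (trans (switch-common-same-side x y (cong low same-class))
           (cong (_+ 2 * suc m) (sameClass x y x≢y same-class)))

  switch-diff-class : ∀ x y → cls x ≢ cls y → common S x y ≡ 2
  switch-diff-class x y different with low (cls x) ≟ᵇ low (cls y)
  ... | yes same-side = same-side-arithmetic m _
    (trans (switch-common-same-side x y same-side) (cong (_+ 2 * suc m) (diffClass x y different)))
  ... | no  opposite  = opposite-sides-arithmetic m _
    (trans (cong (common S x y +_) (sym (diffClass x y different)))
           (switch-common-opposite-sides x y (¬-not (opposite ∘ sym))))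

  switch-DDG : IsDDG v (suc m + 2) (suc m ∸ 2) 2 4 (suc m) S cls
  switch-DDG = record
    { simple    = switch-simple adj cls simple
    ; vertices  = vertices
    ; classSize = classSize
    ; regular   = switch-regular
    ; sameClass = switch-same-class
    ; diffClass = switch-diff-class
    }

lemma10 : (n : ℕ) → n ≥ 1
    → (adj : Fin (4 * n) → Fin (4 * n) → Bool) → (cls : Fin (4 * n) → Fin 4)
    → IsDDG (4 * n) (3 * n ∸ 2) (3 * n ∸ 6) (2 * n ∸ 2) 4 n adj cls
    → HasQuotient adj cls (Q₁ n)
    → IsDDG (4 * n) (n + 2) (n ∸ 2) 2 4 n (switch adj cls) cls
      × HasQuotient (switch adj cls) cls (Q₂ n)
lemma10 (suc m) _ adj cls G quotient = switch-DDG , switch-quotient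
  where open SwitchedDDG G quotient
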